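{- Let $Z$ be a set, let $\mathcal{Y}\subseteq\mathcal{P}(Z)$ be closed under finite unions, and let $\mu:\mathcal{Y}\to\mathcal{P}(Z)$ satisfy $(\mu\subseteq)$, $(\mu PR)$ and $(\mu CUM)$. Then for all $A,B,X,U,Y\in\mathcal{Y}$: (1) $\mu(A)\subseteq B$ implies $\mu(A\cup B)=\mu(B)$; (2) $\mu(X)\subseteq U$ and $U\subseteq Y$ imply $\mu(Y\cup X)=\mu(Y)$; (3) $\mu(X)\subseteq U$ and $U\subseteq Y$ imply $\mu(Y)\cap X\subseteq\mu(U)$; (4) $\mu(X)\subseteq U$ implies $\mu(U)\cap X\subseteq\mu(X)$; (5) $U\subseteq A$ and $\mu(A)\subseteq H(U)$ imply $\mu(A)\subseteq U$; (6) if $x\in K$ and $x\in Y-\mu(Y)$, then $\mu(Y)\neq\emptyset$.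
   Context: For all $X,Y\in\mathcal{Y}$: $(\mu\subseteq)$ $\mu(X)\subseteq X$; $(\mu PR)$ $X\subseteq Y\Rightarrow\mu(Y)\cap X\subseteq\mu(X)$; $(\mu CUM)$ $\mu(X)\subseteq Y\subseteq X\Rightarrow\mu(Y)=\mu(X)$. For $U\in\mathcal{Y}$, $H(U):=\bigcup\{X\in\mathcal{Y}:\mu(X)\subseteq U\}$. $K:=\{x\in Z:\exists X\in\mathcal{Y}.\,x\in\mu(X)\}$. -}

module Defs where

open import Level using (0ℓ; suc)
open import Data.Product using (Σ; ∃; _×_)
open import Relation.Unary using (Pred; _⊆_; _∩_; _∪_; _≐_; _∈_)

Family : Set → Set₁
Family Z = Pred Z 0ℓ → Set

ChoiceFun : {Z : Set} → Family Z → Set₁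
ChoiceFun {Z} 𝒴 = (X : Pred Z 0ℓ) → 𝒴 X → Pred Z 0ℓ

ClosedUnion : {Z : Set} → Family Z → Set₁
ClosedUnion {Z} 𝒴 = ∀ {X Y : Pred Z 0ℓ} → 𝒴 X → 𝒴 Y → 𝒴 (X ∪ Y)

Mu⊆ : {Z : Set} (𝒴 : Family Z) → ChoiceFun 𝒴 → Set₁
Mu⊆ {Z} 𝒴 μ = ∀ (X : Pred Z 0ℓ) (p : 𝒴 X) → μ X p ⊆ X

MuPR : {Z : Set} (𝒴 : Family Z) → ChoiceFun 𝒴 → Set₁
MuPR {Z} 𝒴 μ = ∀ (X Y : Pred Z 0ℓ) (p : 𝒴 X) (q : 𝒴 Y) →
  X ⊆ Y → (μ Y q ∩ X) ⊆ μ X p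

MuCUM : {Z : Set} (𝒴 : Family Z) → ChoiceFun 𝒴 → Set₁
MuCUM {Z} 𝒴 μ = ∀ (X Y : Pred Z 0ℓ) (p : 𝒴 X) (q : 𝒴 Y) →
  μ X p ⊆ Y → Y ⊆ X → μ Y q ≐ μ X p

H : {Z : Set} (𝒴 : Family Z) → ChoiceFun 𝒴 → Pred Z 0ℓ → Pred Z (suc 0ℓ)
H {Z} 𝒴 μ U z = Σ (Pred Z 0ℓ) λ X → Σ (𝒴 X) λ p → (μ X p ⊆ U) × (z ∈ X)

K : {Z : Set} (𝒴 : Family Z) → ChoiceFun 𝒴 → Pred Z (suc 0ℓ)
K {Z} 𝒴 μ z = Σ (Pred Z 0ℓ) λ X → Σ (𝒴 X) λ p → z ∈ μ X p

module Submission where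

-- Idea of the proof.  Everything rests on one "absorption" principle for a
-- choice function μ satisfying (μ⊆), (μPR) and (μCUM):
--
--   if A, B ⊆ W ⊆ A ∪ B and μ(A) ⊆ B, then μ(W) = μ(B).
--
-- Indeed μ(W) ⊆ W ⊆ A ∪ B, and a point of μ(W) lying in A lies in μ(A) ⊆ B
-- by (μPR); so μ(W) ⊆ B ⊆ W and (μCUM) gives μ(B) = μ(W).  Taking W to be
-- A ∪ B or B ∪ A yields part (1) and its mirror image.  Part (2) is the
-- mirror image applied to μ(X) ⊆ U ⊆ Y.  Parts (3) and (4) transport a
-- point of μ(Y) ∩ X (resp. μ(U) ∩ X) into μ of the union, and then down to
-- μ(U) (resp. μ(X)) by (μPR).  Part (5) is part (3) applied pointwise to
-- the witnesses of H(U), and part (6) is part (4) for the vacuous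
-- inclusion μ(Y) = ∅ ⊆ X, where X is a witness of x ∈ K.

open import Defs
open import Level using (0ℓ)
open import Data.Product using (_×_; _,_; proj₂)
open import Data.Sum using (inj₁; inj₂; swap)
open import Data.Empty using (⊥-elim)
open import Relation.Nullary using (¬_)
open import Relation.Unary using (Pred; _⊆_; _∩_; _∪_; _≐_; _∈_; _∉_; Empty)
open import Relation.Unary.Properties using (≐-sym)

module CumulativeChoice {Z : Set} (𝒴 : Family Z) (μ : ChoiceFun 𝒴)
  (μ⊆ : Mu⊆ 𝒴 μ) (μPR : MuPR 𝒴 μ) (μCUM : MuCUM 𝒴 μ) where

  absorb : (W A B : Pred Z 0ℓ) (pW : 𝒴 W) (pA : 𝒴 A) (pB : 𝒴 B) →
    A ⊆ W → B ⊆ W → W ⊆ A ∪ B → μ A pA ⊆ B → μ W pW ≐ μ B pB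
  absorb W A B pW pA pB A⊆W B⊆W W⊆A∪B μA⊆B =
    ≐-sym (μCUM W B pW pB μW⊆B B⊆W)
    where
    μW⊆B : μ W pW ⊆ B
    μW⊆B z∈μW with W⊆A∪B (μ⊆ W pW z∈μW)
    ... | inj₁ z∈A = μA⊆B (μPR A W pA pW A⊆W (z∈μW , z∈A))
    ... | inj₂ z∈B = z∈B

  absorbˡ : (A B : Pred Z 0ℓ) (pA : 𝒴 A) (pB : 𝒴 B) (pAB : 𝒴 (A ∪ B)) →
    μ A pA ⊆ B → μ (A ∪ B) pAB ≐ μ B pB
  absorbˡ A B pA pB pAB = absorb (A ∪ B) A B pAB pA pB inj₁ inj₂ (λ z → z)

  absorbʳ : (A B : Pred Z 0ℓ) (pA : 𝒴 A) (pB : 𝒴 B) (pBA : 𝒴 (B ∪ A)) →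
    μ A pA ⊆ B → μ (B ∪ A) pBA ≐ μ B pB
  absorbʳ A B pA pB pBA = absorb (B ∪ A) A B pBA pA pB inj₂ inj₁ swap

  absorb-above : (X U Y : Pred Z 0ℓ) (pX : 𝒴 X) (pY : 𝒴 Y) (pYX : 𝒴 (Y ∪ X)) →
    μ X pX ⊆ U → U ⊆ Y → μ (Y ∪ X) pYX ≐ μ Y pY
  absorb-above X U Y pX pY pYX μX⊆U U⊆Y =
    absorbʳ X Y pX pY pYX (λ z∈μX → U⊆Y (μX⊆U z∈μX))

  -- Part (3): if μ(X) ⊆ U ⊆ Y then μ(Y) ∩ X ⊆ μ(U).  A point of μ(Y) ∩ X
  -- lies in μ(Y ∪ X) by part (2), hence in μ(X) ⊆ U, hence in μ(U).
  restrict-between : (X U Y : Pred Z 0ℓ) (pX : 𝒴 X) (pU : 𝒴 U) (pY : 𝒴 Y)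
    (pYX : 𝒴 (Y ∪ X)) → μ X pX ⊆ U → U ⊆ Y → μ Y pY ∩ X ⊆ μ U pU
  restrict-between X U Y pX pU pY pYX μX⊆U U⊆Y {z} (z∈μY , z∈X) =
    μPR U (Y ∪ X) pU pYX (λ z∈U → inj₁ (U⊆Y z∈U)) (z∈μYX , μX⊆U z∈μX)
    where
    z∈μYX : z ∈ μ (Y ∪ X) pYX
    z∈μYX = proj₂ (absorb-above X U Y pX pY pYX μX⊆U U⊆Y) z∈μY

    z∈μX : z ∈ μ X pX
    z∈μX = μPR X (Y ∪ X) pX pYX inj₂ (z∈μYX , z∈X)

  -- Part (4): if μ(X) ⊆ U then μ(U) ∩ X ⊆ μ(X), since μ(U) = μ(U ∪ X).
  restrict-below : (X U : Pred Z 0ℓ) (pX : 𝒴 X) (pU : 𝒴 U) (pUX : 𝒴 (U ∪ X)) →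
    μ X pX ⊆ U → μ U pU ∩ X ⊆ μ X pX
  restrict-below X U pX pU pUX μX⊆U (z∈μU , z∈X) =
    μPR X (U ∪ X) pX pUX inj₂ (proj₂ (absorbʳ X U pX pU pUX μX⊆U) z∈μU , z∈X)

  -- Part (5): for U ⊆ A, μ(A) ⊆ H(U) already forces μ(A) ⊆ U; each point of
  -- μ(A) lies in some X with μ(X) ⊆ U, and part (3) puts it in μ(U) ⊆ U.
  within-H : (cl : ClosedUnion 𝒴) (U A : Pred Z 0ℓ) (pU : 𝒴 U) (pA : 𝒴 A) →
    U ⊆ A → μ A pA ⊆ H 𝒴 μ U → μ A pA ⊆ U
  within-H cl U A pU pA U⊆A μA⊆HU z∈μA with μA⊆HU z∈μA
  ... | X , pX , μX⊆U , z∈X =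
    μ⊆ U pU (restrict-between X U A pX pU pA (cl pA pX) μX⊆U U⊆A (z∈μA , z∈X))

  -- Part (6): if μ(Y) were empty it would lie inside the witness X of
  -- x ∈ K, so by part (4) x ∈ μ(X) ∩ Y ⊆ μ(Y), contradicting x ∉ μ(Y).
  nonempty : (cl : ClosedUnion 𝒴) (x : Z) (Y : Pred Z 0ℓ) (pY : 𝒴 Y) →
    x ∈ K 𝒴 μ → x ∈ Y → x ∉ μ Y pY → ¬ Empty (μ Y pY)
  nonempty cl x Y pY (X , pX , x∈μX) x∈Y x∉μY μY-empty =
    x∉μY (restrict-below Y X pY pX (cl pX pY) μY⊆X (x∈μX , x∈Y))
    where
    μY⊆X : μ Y pY ⊆ X
    μY⊆X {z} z∈μY = ⊥-elim (μY-empty z z∈μY)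

fact3p14 : {Z : Set} (𝒴 : Family Z) (μ : ChoiceFun 𝒴) (cl : ClosedUnion 𝒴) →
    Mu⊆ 𝒴 μ → MuPR 𝒴 μ → MuCUM 𝒴 μ →
    (∀ (A B : Pred Z 0ℓ) (pA : 𝒴 A) (pB : 𝒴 B) →
       μ A pA ⊆ B → μ (A ∪ B) (cl pA pB) ≐ μ B pB)
    × (∀ (X U Y : Pred Z 0ℓ) (pX : 𝒴 X) (pU : 𝒴 U) (pY : 𝒴 Y) →
       μ X pX ⊆ U → U ⊆ Y → μ (Y ∪ X) (cl pY pX) ≐ μ Y pY)
    × (∀ (X U Y : Pred Z 0ℓ) (pX : 𝒴 X) (pU : 𝒴 U) (pY : 𝒴 Y) →
       μ X pX ⊆ U → U ⊆ Y → (μ Y pY ∩ X) ⊆ μ U pU)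
    × (∀ (X U : Pred Z 0ℓ) (pX : 𝒴 X) (pU : 𝒴 U) →
       μ X pX ⊆ U → (μ U pU ∩ X) ⊆ μ X pX)
    × (∀ (U A : Pred Z 0ℓ) (pU : 𝒴 U) (pA : 𝒴 A) →
       U ⊆ A → μ A pA ⊆ H 𝒴 μ U → μ A pA ⊆ U)
    × (∀ (x : Z) (Y : Pred Z 0ℓ) (pY : 𝒴 Y) →
       x ∈ K 𝒴 μ → x ∈ Y → x ∉ μ Y pY → ¬ Empty (μ Y pY))
fact3p14 𝒴 μ cl μ⊆ μPR μCUM =
    (λ A B pA pB → absorbˡ A B pA pB (cl pA pB))
  , (λ X U Y pX pU pY → absorb-above X U Y pX pY (cl pY pX))
  , (λ X U Y pX pU pY → restrict-between X U Y pX pU pY (cl pY pX))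
  , (λ X U pX pU → restrict-below X U pX pU (cl pU pX))
  , within-H cl
  , nonempty cl
  where open CumulativeChoice 𝒴 μ μ⊆ μPR μCUM
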